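{- For channelled transition systems $\mathcal T_1,\mathcal T_2,\mathcal T_3$: (i) $\mathcal T_1\|\mathcal T_2=\mathcal T_2\|\mathcal T_1$; (ii) $(\mathcal T_1\|\mathcal T_2)\|\mathcal T_3=\mathcal T_1\|(\mathcal T_2\|\mathcal T_3)$, where equality is understood up to the identification of product states $(s_1,s_2)\leftrightarrow(s_2,s_1)$ and $((s_1,s_2),s_3)\leftrightarrow(s_1,(s_2,s_3))$ (and correspondingly of labels).
   Context: A channelled transition system (CTS) is $\mathcal T=\langle C,\Sigma,\Upsilon,S,S_0,R,L,ls\rangle$: $C$ a set of channels including a broadcast channel $\star$; $\Sigma$ a state alphabet; $\Upsilon=\Upsilon^+\times\{!,?\}\times C$ a transition alphabet ($!$ = send, $?$ = receive); $S$ states; $S_0\subseteq S$ initial states; $R\subseteq S\times\Upsilon\times S$; $L:S\to\Sigma$; $ls:S\to 2^C$ with $\star\in ls(s)$ for every $s$. The composition $\mathcal T_1\|\mathcal T_2=\langle C,\Sigma,\Upsilon,S,S_0,R,L,ls\rangle$ has $C=C_1\cup C_2$, $\Sigma=\Sigma_1\times\Sigma_2$, $\Upsilon=\Upsilon^1\cup\Upsilon^2$, $S=S_1\times S_2$, $S_0=S_0^1\times S_0^2$, $L(s_1,s_2)=(L_1(s_1),L_2(s_2))$, $ls(s_1,s_2)=ls^1(s_1)\cup ls^2(s_2)$, and $R$ the union of: (a) all $((s_1,s_2),(\upsilon,!,c),(s_1',s_2'))$ such that [$(s_1,(\upsilon,!,c),s_1')\in R_1$ and $(s_2,(\upsilon,?,c),s_2')\in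 R_2$] or [$(s_1,(\upsilon,?,c),s_1')\in R_1$ and $(s_2,(\upsilon,!,c),s_2')\in R_2$] or [$(s_1,(\upsilon,!,c),s_1')\in R_1$, $c\notin ls^2(s_2)$, $s_2=s_2'$] or [$c\notin ls^1(s_1)$, $s_1=s_1'$, $(s_2,(\upsilon,!,c),s_2')\in R_2$]; (b) all $((s_1,s_2),(\upsilon,?,c),(s_1',s_2'))$ such that [$(s_1,(\upsilon,?,c),s_1')\in R_1$ and $(s_2,(\upsilon,?,c),s_2')\in R_2$] or [$(s_1,(\upsilon,?,c),s_1')\in R_1$, $c\notin ls^2(s_2)$, $s_2=s_2'$] or [$c\notin ls^1(s_1)$, $s_1=s_1'$, $(s_2,(\upsilon,?,c),s_2')\in R_2$]; (c) all $((s_1,s_2),(\upsilon,\gamma,\star),(s_1',s_2'))$ with $\gamma\in\{!,?\}$ such that [$(s_1,(\upsilon,\gamma,\star),s_1')\in R_1$, $s_2=s_2'$, and $(s_2,(\upsilon,?,\star),s_2'')\notin R_2$ for all $s_2''$] or [$s_1=s_1'$, $(s_1,(\upsilon,?,\star),s_1'')\notin R_1$ for all $s_1''$, and $(s_2,(\upsilon,\gamma,\star),s_2')\in R_2$]. -}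

module Defs where

open import Level using (0ℓ)
open import Data.Product using (_×_; _,_; proj₁; proj₂; swap; assocʳ′; assocˡ′)
open import Data.Sum using (_⊎_)
open import Relation.Nullary using (¬_)
open import Relation.Binary.PropositionalEquality using (_≡_)
open import Function.Bundles using (_⇔_)

data Dir : Set where
  send recv : Dir

-- A channelled transition system over a universe of channels Ch with a
-- distinguished broadcast channel ★, and a universe of message values M.
-- Sets (C, Υ⁺, S₀, ls s) are predicates; the transition alphabet is
-- Υ = Υ⁺ × Dir × C, and R s υ γ c s' means (s , (υ , γ , c) , s') ∈ R.
record CTS (Ch : Set) (★ : Ch) (M : Set) : Set₁ where
  field
    C    : Ch → Set
    ★∈C  : C ★
    Alph : Set
    Υ⁺   : M → Set
    S    : Set
    S₀   : S → Set
    R    : S → M → Dir → Ch → S → Set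
    L    : S → Alph
    ls   : S → Ch → Set
    ★∈ls : ∀ s → ls s ★

open CTS

module _ {Ch : Set} {★ : Ch} {M : Set} where

  ruleA : (T₁ T₂ : CTS Ch ★ M) → S T₁ × S T₂ → M → Ch → S T₁ × S T₂ → Set
  ruleA T₁ T₂ (s₁ , s₂) υ c (s₁' , s₂') =
      (R T₁ s₁ υ send c s₁' × R T₂ s₂ υ recv c s₂')
    ⊎ (R T₁ s₁ υ recv c s₁' × R T₂ s₂ υ send c s₂')
    ⊎ (R T₁ s₁ υ send c s₁' × ¬ ls T₂ s₂ c × s₂ ≡ s₂')
    ⊎ (¬ ls T₁ s₁ c × s₁ ≡ s₁' × R T₂ s₂ υ send c s₂')

  ruleB : (T₁ T₂ : CTS Ch ★ M) → S T₁ × S T₂ → M → Ch → S T₁ × S T₂ → Set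
  ruleB T₁ T₂ (s₁ , s₂) υ c (s₁' , s₂') =
      (R T₁ s₁ υ recv c s₁' × R T₂ s₂ υ recv c s₂')
    ⊎ (R T₁ s₁ υ recv c s₁' × ¬ ls T₂ s₂ c × s₂ ≡ s₂')
    ⊎ (¬ ls T₁ s₁ c × s₁ ≡ s₁' × R T₂ s₂ υ recv c s₂')

  ruleC : (T₁ T₂ : CTS Ch ★ M) → S T₁ × S T₂ → M → Dir → Ch → S T₁ × S T₂ → Set
  ruleC T₁ T₂ (s₁ , s₂) υ γ c (s₁' , s₂') =
    c ≡ ★ ×
    (   (R T₁ s₁ υ γ ★ s₁' × s₂ ≡ s₂' × (∀ s₂'' → ¬ R T₂ s₂ υ recv ★ s₂''))
      ⊎ (s₁ ≡ s₁' × (∀ s₁'' → ¬ R T₁ s₁ υ recv ★ s₁'') × R T₂ s₂ υ γ ★ s₂'))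

  compR : (T₁ T₂ : CTS Ch ★ M) → S T₁ × S T₂ → M → Dir → Ch → S T₁ × S T₂ → Set
  compR T₁ T₂ s υ send c s' = ruleA T₁ T₂ s υ c s' ⊎ ruleC T₁ T₂ s υ send c s'
  compR T₁ T₂ s υ recv c s' = ruleB T₁ T₂ s υ c s' ⊎ ruleC T₁ T₂ s υ recv c s'

  infixl 5 _∥_
  _∥_ : CTS Ch ★ M → CTS Ch ★ M → CTS Ch ★ M
  T₁ ∥ T₂ = record
    { C    = λ c → C T₁ c ⊎ C T₂ c
    ; ★∈C  = Data.Sum.inj₁ (★∈C T₁)
    ; Alph = Alph T₁ × Alph T₂
    ; Υ⁺   = λ υ → Υ⁺ T₁ υ ⊎ Υ⁺ T₂ υ
    ; S    = S T₁ × S T₂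
    ; S₀   = λ { (s₁ , s₂) → S₀ T₁ s₁ × S₀ T₂ s₂ }
    ; R    = compR T₁ T₂
    ; L    = λ { (s₁ , s₂) → (L T₁ s₁ , L T₂ s₂) }
    ; ls   = λ { (s₁ , s₂) c → ls T₁ s₁ c ⊎ ls T₂ s₂ c }
    ; ★∈ls = λ { (s₁ , s₂) → Data.Sum.inj₁ (★∈ls T₁ s₁) }
    }

  record SameUpTo (T T' : CTS Ch ★ M)
                  (f : S T → S T') (f⁻ : S T' → S T)
                  (g : Alph T → Alph T') : Set₁ where
    field
      inv₁ : ∀ s → f⁻ (f s) ≡ s
      inv₂ : ∀ s' → f (f⁻ s') ≡ s'
      C≡   : ∀ c → C T c ⇔ C T' c
      Υ⁺≡  : ∀ υ → Υ⁺ T υ ⇔ Υ⁺ T' υ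
      S₀≡  : ∀ s → S₀ T s ⇔ S₀ T' (f s)
      R≡   : ∀ s υ γ c t → R T s υ γ c t ⇔ R T' (f s) υ γ c (f t)
      L≡   : ∀ s → L T' (f s) ≡ g (L T s)
      ls≡  : ∀ s c → ls T s c ⇔ ls T' (f s) c

-- Commutativity is a relabelling of the rules of ∥: each clause of (a), (b),
-- (c) for T₁ ∥ T₂ is a clause for T₂ ∥ T₁ with the roles exchanged.
-- Two facts make the cases line up: every state listens on ★, so a component
-- can never sit out a ★-step under rules (a) and (b); and a composite state is
-- unable to receive υ on ★ exactly when both of its components are, which is
-- the side condition of rule (c) on either bracketing.
module Submission where

open import Defs
open import Data.Product using (_×_; _,_; ∃; swap; assocʳ′; assocˡ′)
open import Data.Sum using (_⊎_; inj₁; inj₂)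
import Data.Sum as Sum
open import Data.Empty using (⊥-elim)
open import Relation.Nullary using (¬_; yes; no)
open import Relation.Nullary.Decidable using (¬¬-excluded-middle)
open import Relation.Binary.PropositionalEquality using (refl)
open import Function.Base using (_∘_)
open import Function.Bundles using (_⇔_; mk⇔)

open CTS

⊎-comm⇔ : {A B : Set} → (A ⊎ B) ⇔ (B ⊎ A)
⊎-comm⇔ = mk⇔ Sum.swap Sum.swap

⊎-assoc⇔ : {A B C : Set} → ((A ⊎ B) ⊎ C) ⇔ (A ⊎ (B ⊎ C))
⊎-assoc⇔ = mk⇔ Sum.assocʳ Sum.assocˡ

pattern sendRecv r₁ r₂     = inj₁ (inj₁ (r₁ , r₂))
pattern recvSend r₁ r₂     = inj₁ (inj₂ (inj₁ (r₁ , r₂)))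
pattern sendˡ r₁ ¬l₂ e     = inj₁ (inj₂ (inj₂ (inj₁ (r₁ , ¬l₂ , e))))
pattern sendʳ ¬l₁ e r₂     = inj₁ (inj₂ (inj₂ (inj₂ (¬l₁ , e , r₂))))
pattern recvRecv r₁ r₂     = inj₁ (inj₁ (r₁ , r₂))
pattern recvˡ r₁ ¬l₂ e     = inj₁ (inj₂ (inj₁ (r₁ , ¬l₂ , e)))
pattern recvʳ ¬l₁ e r₂     = inj₁ (inj₂ (inj₂ (¬l₁ , e , r₂)))
pattern broadcastˡ r₁ e n₂ = inj₂ (refl , inj₁ (r₁ , e , n₂))
pattern broadcastʳ e n₁ r₂ = inj₂ (refl , inj₂ (e , n₁ , r₂))

module _ {Ch : Set} {★ : Ch} {M : Set} where

  NoBroadcastRecv : (T : CTS Ch ★ M) → S T → M → Set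
  NoBroadcastRecv T s υ = ∀ t → ¬ R T s υ recv ★ t

  noBroadcastRecv-∥ : (T₁ T₂ : CTS Ch ★ M) {s₁ : S T₁} {s₂ : S T₂} {υ : M} →
    NoBroadcastRecv T₁ s₁ υ → NoBroadcastRecv T₂ s₂ υ →
    NoBroadcastRecv (T₁ ∥ T₂) (s₁ , s₂) υ
  noBroadcastRecv-∥ T₁ T₂ n₁ n₂ (t₁ , t₂) (recvRecv r₁ _)     = n₁ t₁ r₁
  noBroadcastRecv-∥ T₁ T₂ n₁ n₂ (t₁ , t₂) (recvˡ r₁ _ _)      = n₁ t₁ r₁
  noBroadcastRecv-∥ T₁ T₂ n₁ n₂ (t₁ , t₂) (recvʳ _ _ r₂)      = n₂ t₂ r₂
  noBroadcastRecv-∥ T₁ T₂ n₁ n₂ (t₁ , t₂) (broadcastˡ r₁ _ _) = n₁ t₁ r₁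
  noBroadcastRecv-∥ T₁ T₂ n₁ n₂ (t₁ , t₂) (broadcastʳ _ _ r₂) = n₂ t₂ r₂

  -- Whether the other component can receive is not decidable, but refuting
  -- both alternatives is enough: ¬¬ (Dec P) holds constructively.
  noBroadcastRecv-∥⁻ : (T₁ T₂ : CTS Ch ★ M) {s₁ : S T₁} {s₂ : S T₂} {υ : M} →
    NoBroadcastRecv (T₁ ∥ T₂) (s₁ , s₂) υ →
    NoBroadcastRecv T₁ s₁ υ × NoBroadcastRecv T₂ s₂ υ
  noBroadcastRecv-∥⁻ T₁ T₂ {s₁} {s₂} {υ} n = left , right
    where
    left : NoBroadcastRecv T₁ s₁ υ
    left t₁ r₁ = ¬¬-excluded-middle {A = ∃ (R T₂ s₂ υ recv ★)} λ
      { (yes (t₂ , r₂)) → n (t₁ , t₂) (recvRecv r₁ r₂)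
      ; (no ¬r₂)        → n (t₁ , s₂) (broadcastˡ r₁ refl λ t₂ r₂ → ¬r₂ (t₂ , r₂)) }

    right : NoBroadcastRecv T₂ s₂ υ
    right t₂ r₂ = ¬¬-excluded-middle {A = ∃ (R T₁ s₁ υ recv ★)} λ
      { (yes (t₁ , r₁)) → n (t₁ , t₂) (recvRecv r₁ r₂)
      ; (no ¬r₁)        → n (s₁ , t₂) (broadcastʳ refl (λ t₁ r₁ → ¬r₁ (t₁ , r₁)) r₂) }

  ∥-R-swap : (T₁ T₂ : CTS Ch ★ M) {s₁ t₁ : S T₁} {s₂ t₂ : S T₂} {υ : M} (γ : Dir) {c : Ch} →
    R (T₁ ∥ T₂) (s₁ , s₂) υ γ c (t₁ , t₂) → R (T₂ ∥ T₁) (s₂ , s₁) υ γ c (t₂ , t₁)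
  ∥-R-swap T₁ T₂ send (sendRecv r₁ r₂)      = recvSend r₂ r₁
  ∥-R-swap T₁ T₂ send (recvSend r₁ r₂)      = sendRecv r₂ r₁
  ∥-R-swap T₁ T₂ send (sendˡ r₁ ¬l₂ e)      = sendʳ ¬l₂ e r₁
  ∥-R-swap T₁ T₂ send (sendʳ ¬l₁ e r₂)      = sendˡ r₂ ¬l₁ e
  ∥-R-swap T₁ T₂ send (broadcastˡ r₁ e n₂)  = broadcastʳ e n₂ r₁
  ∥-R-swap T₁ T₂ send (broadcastʳ e n₁ r₂)  = broadcastˡ r₂ e n₁
  ∥-R-swap T₁ T₂ recv (recvRecv r₁ r₂)      = recvRecv r₂ r₁
  ∥-R-swap T₁ T₂ recv (recvˡ r₁ ¬l₂ e)      = recvʳ ¬l₂ e r₁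
  ∥-R-swap T₁ T₂ recv (recvʳ ¬l₁ e r₂)      = recvˡ r₂ ¬l₁ e
  ∥-R-swap T₁ T₂ recv (broadcastˡ r₁ e n₂)  = broadcastʳ e n₂ r₁
  ∥-R-swap T₁ T₂ recv (broadcastʳ e n₁ r₂)  = broadcastˡ r₂ e n₁

  ∥-comm : (T₁ T₂ : CTS Ch ★ M) → SameUpTo (T₁ ∥ T₂) (T₂ ∥ T₁) swap swap swap
  ∥-comm T₁ T₂ = record
    { inv₁ = λ _ → refl
    ; inv₂ = λ _ → refl
    ; C≡   = λ _ → ⊎-comm⇔
    ; Υ⁺≡  = λ _ → ⊎-comm⇔
    ; S₀≡  = λ _ → mk⇔ swap swap
    ; R≡   = λ { _ _ γ _ _ → mk⇔ (∥-R-swap T₁ T₂ γ) (∥-R-swap T₂ T₁ γ) }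
    ; L≡   = λ _ → refl
    ; ls≡  = λ _ _ → ⊎-comm⇔
    }

  module _ (T₁ T₂ T₃ : CTS Ch ★ M) where

    ∥-R-assocʳ-send : ∀ {s₁ s₂ s₃ t₁ t₂ t₃ υ c} →
      R ((T₁ ∥ T₂) ∥ T₃) ((s₁ , s₂) , s₃) υ send c ((t₁ , t₂) , t₃) →
      R (T₁ ∥ (T₂ ∥ T₃)) (s₁ , (s₂ , s₃)) υ send c (t₁ , (t₂ , t₃))
    ∥-R-assocʳ-send (sendRecv (sendRecv x y) z)        = sendRecv x (recvRecv y z)
    ∥-R-assocʳ-send (sendRecv (recvSend x y) z)        = recvSend x (sendRecv y z)
    ∥-R-assocʳ-send (sendRecv (sendˡ x n refl) z)      = sendRecv x (recvʳ n refl z)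
    ∥-R-assocʳ-send (sendRecv (sendʳ n refl y) z)      = sendʳ n refl (sendRecv y z)
    ∥-R-assocʳ-send (sendRecv (broadcastˡ x refl n) z) = sendRecv x (broadcastʳ refl n z)
    ∥-R-assocʳ-send (sendRecv (broadcastʳ refl n y) z) = broadcastʳ refl n (sendRecv y z)
    ∥-R-assocʳ-send (recvSend (recvRecv x y) z)        = recvSend x (recvSend y z)
    ∥-R-assocʳ-send (recvSend (recvˡ x n refl) z)      = recvSend x (sendʳ n refl z)
    ∥-R-assocʳ-send (recvSend (recvʳ n refl y) z)      = sendʳ n refl (recvSend y z)
    ∥-R-assocʳ-send (recvSend (broadcastˡ x refl n) z) = recvSend x (broadcastʳ refl n z)
    ∥-R-assocʳ-send (recvSend (broadcastʳ refl n y) z) = broadcastʳ refl n (recvSend y z)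
    ∥-R-assocʳ-send (sendˡ (sendRecv x y) n refl)      = sendRecv x (recvˡ y n refl)
    ∥-R-assocʳ-send (sendˡ (recvSend x y) n refl)      = recvSend x (sendˡ y n refl)
    ∥-R-assocʳ-send (sendˡ (sendˡ x n₂ refl) n₃ refl)  = sendˡ x (Sum.[ n₂ , n₃ ]) refl
    ∥-R-assocʳ-send (sendˡ (sendʳ n₁ refl y) n₃ refl)  = sendʳ n₁ refl (sendˡ y n₃ refl)
    ∥-R-assocʳ-send {s₃ = s₃} (sendˡ (broadcastˡ _ _ _) n refl) = ⊥-elim (n (★∈ls T₃ s₃))
    ∥-R-assocʳ-send {s₃ = s₃} (sendˡ (broadcastʳ _ _ _) n refl) = ⊥-elim (n (★∈ls T₃ s₃))
    ∥-R-assocʳ-send (sendʳ n refl z)                   = sendʳ (n ∘ inj₁) refl (sendʳ (n ∘ inj₂) refl z)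
    ∥-R-assocʳ-send (broadcastˡ (sendRecv x y) refl n) = sendRecv x (broadcastˡ y refl n)
    ∥-R-assocʳ-send (broadcastˡ (recvSend x y) refl n) = recvSend x (broadcastˡ y refl n)
    ∥-R-assocʳ-send {s₂ = s₂} (broadcastˡ (sendˡ _ n refl) refl _) = ⊥-elim (n (★∈ls T₂ s₂))
    ∥-R-assocʳ-send {s₁ = s₁} (broadcastˡ (sendʳ n refl _) refl _) = ⊥-elim (n (★∈ls T₁ s₁))
    ∥-R-assocʳ-send (broadcastˡ (broadcastˡ x refl n₂) refl n₃) =
      broadcastˡ x refl (noBroadcastRecv-∥ T₂ T₃ n₂ n₃)
    ∥-R-assocʳ-send (broadcastˡ (broadcastʳ refl n₁ y) refl n₃) =
      broadcastʳ refl n₁ (broadcastˡ y refl n₃)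
    ∥-R-assocʳ-send (broadcastʳ refl n₁₂ z) with noBroadcastRecv-∥⁻ T₁ T₂ n₁₂
    ... | n₁ , n₂ = broadcastʳ refl n₁ (broadcastʳ refl n₂ z)

    ∥-R-assocʳ-recv : ∀ {s₁ s₂ s₃ t₁ t₂ t₃ υ c} →
      R ((T₁ ∥ T₂) ∥ T₃) ((s₁ , s₂) , s₃) υ recv c ((t₁ , t₂) , t₃) →
      R (T₁ ∥ (T₂ ∥ T₃)) (s₁ , (s₂ , s₃)) υ recv c (t₁ , (t₂ , t₃))
    ∥-R-assocʳ-recv (recvRecv (recvRecv x y) z)        = recvRecv x (recvRecv y z)
    ∥-R-assocʳ-recv (recvRecv (recvˡ x n refl) z)      = recvRecv x (recvʳ n refl z)
    ∥-R-assocʳ-recv (recvRecv (recvʳ n refl y) z)      = recvʳ n refl (recvRecv y z)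
    ∥-R-assocʳ-recv (recvRecv (broadcastˡ x refl n) z) = recvRecv x (broadcastʳ refl n z)
    ∥-R-assocʳ-recv (recvRecv (broadcastʳ refl n y) z) = broadcastʳ refl n (recvRecv y z)
    ∥-R-assocʳ-recv (recvˡ (recvRecv x y) n refl)      = recvRecv x (recvˡ y n refl)
    ∥-R-assocʳ-recv (recvˡ (recvˡ x n₂ refl) n₃ refl)  = recvˡ x (Sum.[ n₂ , n₃ ]) refl
    ∥-R-assocʳ-recv (recvˡ (recvʳ n₁ refl y) n₃ refl)  = recvʳ n₁ refl (recvˡ y n₃ refl)
    ∥-R-assocʳ-recv {s₃ = s₃} (recvˡ (broadcastˡ _ _ _) n refl) = ⊥-elim (n (★∈ls T₃ s₃))
    ∥-R-assocʳ-recv {s₃ = s₃} (recvˡ (broadcastʳ _ _ _) n refl) = ⊥-elim (n (★∈ls T₃ s₃))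
    ∥-R-assocʳ-recv (recvʳ n refl z)                   = recvʳ (n ∘ inj₁) refl (recvʳ (n ∘ inj₂) refl z)
    ∥-R-assocʳ-recv (broadcastˡ (recvRecv x y) refl n) = recvRecv x (broadcastˡ y refl n)
    ∥-R-assocʳ-recv {s₂ = s₂} (broadcastˡ (recvˡ _ n refl) refl _) = ⊥-elim (n (★∈ls T₂ s₂))
    ∥-R-assocʳ-recv {s₁ = s₁} (broadcastˡ (recvʳ n refl _) refl _) = ⊥-elim (n (★∈ls T₁ s₁))
    ∥-R-assocʳ-recv (broadcastˡ (broadcastˡ x refl n₂) refl n₃) =
      broadcastˡ x refl (noBroadcastRecv-∥ T₂ T₃ n₂ n₃)
    ∥-R-assocʳ-recv (broadcastˡ (broadcastʳ refl n₁ y) refl n₃) =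
      broadcastʳ refl n₁ (broadcastˡ y refl n₃)
    ∥-R-assocʳ-recv (broadcastʳ refl n₁₂ z) with noBroadcastRecv-∥⁻ T₁ T₂ n₁₂
    ... | n₁ , n₂ = broadcastʳ refl n₁ (broadcastʳ refl n₂ z)

    ∥-R-assocˡ-send : ∀ {s₁ s₂ s₃ t₁ t₂ t₃ υ c} →
      R (T₁ ∥ (T₂ ∥ T₃)) (s₁ , (s₂ , s₃)) υ send c (t₁ , (t₂ , t₃)) →
      R ((T₁ ∥ T₂) ∥ T₃) ((s₁ , s₂) , s₃) υ send c ((t₁ , t₂) , t₃)
    ∥-R-assocˡ-send (sendRecv x (recvRecv y z))        = sendRecv (sendRecv x y) z
    ∥-R-assocˡ-send (sendRecv x (recvˡ y n refl))      = sendˡ (sendRecv x y) n refl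
    ∥-R-assocˡ-send (sendRecv x (recvʳ n refl z))      = sendRecv (sendˡ x n refl) z
    ∥-R-assocˡ-send (sendRecv x (broadcastˡ y refl n)) = broadcastˡ (sendRecv x y) refl n
    ∥-R-assocˡ-send (sendRecv x (broadcastʳ refl n z)) = sendRecv (broadcastˡ x refl n) z
    ∥-R-assocˡ-send (recvSend x (sendRecv y z))        = sendRecv (recvSend x y) z
    ∥-R-assocˡ-send (recvSend x (recvSend y z))        = recvSend (recvRecv x y) z
    ∥-R-assocˡ-send (recvSend x (sendˡ y n refl))      = sendˡ (recvSend x y) n refl
    ∥-R-assocˡ-send (recvSend x (sendʳ n refl z))      = recvSend (recvˡ x n refl) z
    ∥-R-assocˡ-send (recvSend x (broadcastˡ y refl n)) = broadcastˡ (recvSend x y) refl n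
    ∥-R-assocˡ-send (recvSend x (broadcastʳ refl n z)) = recvSend (broadcastˡ x refl n) z
    ∥-R-assocˡ-send (sendˡ x n refl)                   = sendˡ (sendˡ x (n ∘ inj₁) refl) (n ∘ inj₂) refl
    ∥-R-assocˡ-send (sendʳ n refl (sendRecv y z))      = sendRecv (sendʳ n refl y) z
    ∥-R-assocˡ-send (sendʳ n refl (recvSend y z))      = recvSend (recvʳ n refl y) z
    ∥-R-assocˡ-send (sendʳ n₁ refl (sendˡ y n₃ refl))  = sendˡ (sendʳ n₁ refl y) n₃ refl
    ∥-R-assocˡ-send (sendʳ n₁ refl (sendʳ n₂ refl z))  = sendʳ (Sum.[ n₁ , n₂ ]) refl z
    ∥-R-assocˡ-send {s₁ = s₁} (sendʳ n refl (broadcastˡ _ _ _)) = ⊥-elim (n (★∈ls T₁ s₁))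
    ∥-R-assocˡ-send {s₁ = s₁} (sendʳ n refl (broadcastʳ _ _ _)) = ⊥-elim (n (★∈ls T₁ s₁))
    ∥-R-assocˡ-send (broadcastˡ x refl n₂₃) with noBroadcastRecv-∥⁻ T₂ T₃ n₂₃
    ... | n₂ , n₃ = broadcastˡ (broadcastˡ x refl n₂) refl n₃
    ∥-R-assocˡ-send (broadcastʳ refl n (sendRecv y z)) = sendRecv (broadcastʳ refl n y) z
    ∥-R-assocˡ-send (broadcastʳ refl n (recvSend y z)) = recvSend (broadcastʳ refl n y) z
    ∥-R-assocˡ-send {s₃ = s₃} (broadcastʳ refl _ (sendˡ _ n refl)) = ⊥-elim (n (★∈ls T₃ s₃))
    ∥-R-assocˡ-send {s₂ = s₂} (broadcastʳ refl _ (sendʳ n refl _)) = ⊥-elim (n (★∈ls T₂ s₂))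
    ∥-R-assocˡ-send (broadcastʳ refl n₁ (broadcastˡ y refl n₃)) =
      broadcastˡ (broadcastʳ refl n₁ y) refl n₃
    ∥-R-assocˡ-send (broadcastʳ refl n₁ (broadcastʳ refl n₂ z)) =
      broadcastʳ refl (noBroadcastRecv-∥ T₁ T₂ n₁ n₂) z

    ∥-R-assocˡ-recv : ∀ {s₁ s₂ s₃ t₁ t₂ t₃ υ c} →
      R (T₁ ∥ (T₂ ∥ T₃)) (s₁ , (s₂ , s₃)) υ recv c (t₁ , (t₂ , t₃)) →
      R ((T₁ ∥ T₂) ∥ T₃) ((s₁ , s₂) , s₃) υ recv c ((t₁ , t₂) , t₃)
    ∥-R-assocˡ-recv (recvRecv x (recvRecv y z))        = recvRecv (recvRecv x y) z
    ∥-R-assocˡ-recv (recvRecv x (recvˡ y n refl))      = recvˡ (recvRecv x y) n refl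
    ∥-R-assocˡ-recv (recvRecv x (recvʳ n refl z))      = recvRecv (recvˡ x n refl) z
    ∥-R-assocˡ-recv (recvRecv x (broadcastˡ y refl n)) = broadcastˡ (recvRecv x y) refl n
    ∥-R-assocˡ-recv (recvRecv x (broadcastʳ refl n z)) = recvRecv (broadcastˡ x refl n) z
    ∥-R-assocˡ-recv (recvˡ x n refl)                   = recvˡ (recvˡ x (n ∘ inj₁) refl) (n ∘ inj₂) refl
    ∥-R-assocˡ-recv (recvʳ n refl (recvRecv y z))      = recvRecv (recvʳ n refl y) z
    ∥-R-assocˡ-recv (recvʳ n₁ refl (recvˡ y n₃ refl))  = recvˡ (recvʳ n₁ refl y) n₃ refl
    ∥-R-assocˡ-recv (recvʳ n₁ refl (recvʳ n₂ refl z))  = recvʳ (Sum.[ n₁ , n₂ ]) refl z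
    ∥-R-assocˡ-recv {s₁ = s₁} (recvʳ n refl (broadcastˡ _ _ _)) = ⊥-elim (n (★∈ls T₁ s₁))
    ∥-R-assocˡ-recv {s₁ = s₁} (recvʳ n refl (broadcastʳ _ _ _)) = ⊥-elim (n (★∈ls T₁ s₁))
    ∥-R-assocˡ-recv (broadcastˡ x refl n₂₃) with noBroadcastRecv-∥⁻ T₂ T₃ n₂₃
    ... | n₂ , n₃ = broadcastˡ (broadcastˡ x refl n₂) refl n₃
    ∥-R-assocˡ-recv (broadcastʳ refl n (recvRecv y z)) = recvRecv (broadcastʳ refl n y) z
    ∥-R-assocˡ-recv {s₃ = s₃} (broadcastʳ refl _ (recvˡ _ n refl)) = ⊥-elim (n (★∈ls T₃ s₃))
    ∥-R-assocˡ-recv {s₂ = s₂} (broadcastʳ refl _ (recvʳ n refl _)) = ⊥-elim (n (★∈ls T₂ s₂))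
    ∥-R-assocˡ-recv (broadcastʳ refl n₁ (broadcastˡ y refl n₃)) =
      broadcastˡ (broadcastʳ refl n₁ y) refl n₃
    ∥-R-assocˡ-recv (broadcastʳ refl n₁ (broadcastʳ refl n₂ z)) =
      broadcastʳ refl (noBroadcastRecv-∥ T₁ T₂ n₁ n₂) z

    ∥-assoc : SameUpTo ((T₁ ∥ T₂) ∥ T₃) (T₁ ∥ (T₂ ∥ T₃)) assocʳ′ assocˡ′ assocʳ′
    ∥-assoc = record
      { inv₁ = λ _ → refl
      ; inv₂ = λ _ → refl
      ; C≡   = λ _ → ⊎-assoc⇔
      ; Υ⁺≡  = λ _ → ⊎-assoc⇔
      ; S₀≡  = λ _ → mk⇔ assocʳ′ assocˡ′
      ; R≡   = λ { _ _ send _ _ → mk⇔ ∥-R-assocʳ-send ∥-R-assocˡ-send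
                 ; _ _ recv _ _ → mk⇔ ∥-R-assocʳ-recv ∥-R-assocˡ-recv }
      ; L≡   = λ _ → refl
      ; ls≡  = λ _ _ → ⊎-assoc⇔
      }

mainTheorem8 : {Ch : Set} {★ : Ch} {M : Set} (T₁ T₂ T₃ : CTS Ch ★ M) →
    SameUpTo (T₁ ∥ T₂) (T₂ ∥ T₁) swap swap swap
    × SameUpTo ((T₁ ∥ T₂) ∥ T₃) (T₁ ∥ (T₂ ∥ T₃)) assocʳ′ assocˡ′ assocʳ′
mainTheorem8 T₁ T₂ T₃ = ∥-comm T₁ T₂ , ∥-assoc T₁ T₂ T₃
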